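{- If $n\geqslant 3$ is an odd integer, then there is an antichain of size $\dfrac{(n-1)!}{2^{(n-3)/2}}$ in the Bruhat order of $\mathcal{A}(n,2)$.
   Context: $\mathcal{A}(n,k)$ denotes the class of all $n\times n$ matrices with entries in $\{0,1\}$ in which every row and every column sums to $k$. For an $m\times n$ $(0,1)$-matrix $A=[a_{ij}]$ let $\sigma_{ij}(A)=\sum_{k=1}^{i}\sum_{\ell=1}^{j}a_{k\ell}$. For $A,C$ in the same class, $A\preceq_B C$ (Bruhat order) iff $\sigma_{ij}(A)\geqslant\sigma_{ij}(C)$ for all $i,j$. An antichain is a set of pairwise incomparable elements. -}

module Defs where

open import Data.Nat using (ℕ; zero; suc; _+_; _≥_)
open import Data.Bool using (Bool; true; false)
open import Data.Fin using (Fin; toℕ)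
import Data.Fin as Fin
open import Data.List using (List)
open import Data.List.Relation.Unary.All using (All)
open import Data.List.Relation.Unary.AllPairs using (AllPairs)
open import Data.Product using (Σ; _×_)
open import Relation.Binary.PropositionalEquality using (_≡_)
open import Relation.Nullary using (¬_)

Matrix01 : ℕ → ℕ → Set
Matrix01 m n = Fin m → Fin n → Bool

b2n : Bool → ℕ
b2n true  = 1
b2n false = 0

-- sum of f over the first i indices of Fin n (i may exceed n; then all)
prefixSum : {n : ℕ} → ℕ → (Fin n → ℕ) → ℕ
prefixSum {zero}  _       f = 0
prefixSum {suc n} zero    f = 0
prefixSum {suc n} (suc i) f = f Fin.zero + prefixSum {n} i (λ k → f (Fin.suc k))

rowSum : {m n : ℕ} → Matrix01 m n → Fin m → ℕ
rowSum {m} {n} A r = prefixSum n (λ c → b2n (A r c))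

colSum : {m n : ℕ} → Matrix01 m n → Fin n → ℕ
colSum {m} {n} A c = prefixSum m (λ r → b2n (A r c))

InClassA : (n k : ℕ) → Matrix01 n n → Set
InClassA n k A = (∀ r → rowSum A r ≡ k) × (∀ c → colSum A c ≡ k)

-- σ_ij(A) = Σ_{k ≤ i} Σ_{ℓ ≤ j} a_kℓ  (1-based i, j)
σ : {m n : ℕ} → Matrix01 m n → ℕ → ℕ → ℕ
σ A i j = prefixSum i (λ r → prefixSum j (λ c → b2n (A r c)))

_⪯B_ : {m n : ℕ} → Matrix01 m n → Matrix01 m n → Set
_⪯B_ {m} {n} A C = (i : Fin m) (j : Fin n) → σ A (suc (toℕ i)) (suc (toℕ j)) ≥ σ C (suc (toℕ i)) (suc (toℕ j))

Distinct : {m n : ℕ} → Matrix01 m n → Matrix01 m n → Set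
Distinct {m} {n} A C = Σ (Fin m) λ r → Σ (Fin n) λ c → ¬ (A r c ≡ C r c)

Incomparable : {m n : ℕ} → Matrix01 m n → Matrix01 m n → Set
Incomparable A C = ¬ (A ⪯B C) × ¬ (C ⪯B A)

-- an antichain in the Bruhat order of 𝒜(n,k), given as a list of pairwise
-- distinct, pairwise incomparable members of 𝒜(n,k); its size is the list length
IsAntichainA : (n k : ℕ) → List (Matrix01 n n) → Set
IsAntichainA n k L =
  All (InClassA n k) L × AllPairs (λ A C → Distinct A C × Incomparable A C) L

-- Let weight A = Σ_{i,j} σ_ij(A). If A ⪯B C then every σ_ij(A) ≥ σ_ij(C), so weight A ≥ weight C, and
-- equality forces all σ_ij to agree, hence A = C. Distinct matrices of equal weight are therefore pairwise
-- incomparable.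
--
-- Let n = 2k + 3 and describe a matrix of 𝒜(n,2) by the pairs of columns {a_r, b_r} holding the ones of
-- its rows. Since weight A = Σ_{r,c} (n − r)(n − c) a_rc (indices from 0), row r contributes
-- (n − r)((n − a_r) + (n − b_r)). A neutral row {a, n − 1 − a} contributes (n − r)(n + 1), and the two
-- consecutive rows {k, k+1}, {k+1, k+2} (a block) contribute exactly one more than two neutral rows in
-- their place. So every arrangement of the multiset made of one block, the row {k, k+2} and two copies of
-- each row {a, n − 1 − a} with a < k gives a matrix of 𝒜(n,2) of the same weight. These arrangements are
-- enumerated by induction on k: shifting all columns by one and inserting two copies of the new outer row
-- {0, n + 1} in all n(n+1)/2 possible ways yields each arrangement for k + 1 exactly once, so there are
-- (2k+2)!/2^k of them.

{-# OPTIONS --safe #-}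
module Submission where

open import Defs
open import Data.Bool using (Bool; true; false; T; _∨_)
open import Data.Bool.Properties using (T-∨)
import Data.Bool.Properties as Bool
open import Data.Empty using (⊥-elim)
open import Data.Fin using (Fin; toℕ; fromℕ<) renaming (zero to fzero; suc to fsuc)
open import Data.Fin.Properties using (toℕ<n; toℕ-fromℕ<; ¬∀⟶∃¬; all?)
open import Data.List using (List; []; _∷_; _++_; length; map; filter; concat; concatMap)
open import Data.List.Properties
  using (length-map; length-++; map-∘; map-cong; map-injective; ∷-injectiveˡ; ∷-injectiveʳ;
         filter-accept; filter-reject; filter-all)
open import Data.List.Relation.Binary.Permutation.Propositional
  using (_↭_; ↭-refl; ↭-prep; ↭-swap; ↭-trans; ↭-sym)
open import Data.List.Relation.Binary.Permutation.Propositional.Properties using (All-resp-↭; ↭-length)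
import Data.List.Relation.Binary.Permutation.Propositional.Properties as ↭
open import Data.List.Relation.Unary.All using (All; []; _∷_)
import Data.List.Relation.Unary.All as All
import Data.List.Relation.Unary.All.Properties as All
open import Data.List.Relation.Unary.AllPairs using (AllPairs; []; _∷_)
import Data.List.Relation.Unary.AllPairs as AllPairs
import Data.List.Relation.Unary.AllPairs.Properties as AllPairs
open import Data.Nat using (ℕ; zero; suc; _+_; _*_; _∸_; _^_; _≤_; _<_; _!; _≡ᵇ_; z≤n; s≤s; z<s; s<s)
open import Data.Nat.ListAction using (sum)
open import Data.Nat.ListAction.Properties using (sum-↭)
open import Data.Nat.Properties
open import Algebra.Properties.CommutativeSemigroup +-commutativeSemigroup
  using () renaming (interchange to +-interchange)
open import Data.Nat.Tactic.RingSolver using (solve-∀)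
open import Data.Product using (Σ; _×_; _,_; proj₁; proj₂; uncurry)
open import Data.Sum using (_⊎_; inj₁; inj₂)
import Data.Sum as Sum
open import Data.Unit using (⊤; tt)
open import Function using (_∘_)
open import Function.Bundles using (Equivalence)
open import Function.Definitions using (Injective)
open import Relation.Binary.Definitions using (DecidableEquality)
open import Relation.Binary.PropositionalEquality
open import Relation.Nullary using (¬_; ¬?; yes; no)
open import Relation.Nullary.Decidable using (map′; _×-dec_)

prefixSum-cong : ∀ {n} i {f g : Fin n → ℕ} → (∀ x → f x ≡ g x) → prefixSum i f ≡ prefixSum i g
prefixSum-cong {zero}  i       f≗g = refl
prefixSum-cong {suc n} zero    f≗g = refl
prefixSum-cong {suc n} (suc i) f≗g = cong₂ _+_ (f≗g fzero) (prefixSum-cong i (f≗g ∘ fsuc))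

prefixSum-zeroˡ : ∀ {n} (f : Fin n → ℕ) → prefixSum 0 f ≡ 0
prefixSum-zeroˡ {zero}  f = refl
prefixSum-zeroˡ {suc n} f = refl

prefixSum-zeroʳ : ∀ {n} i → prefixSum {n} i (λ _ → 0) ≡ 0
prefixSum-zeroʳ {zero}  i       = refl
prefixSum-zeroʳ {suc n} zero    = refl
prefixSum-zeroʳ {suc n} (suc i) = prefixSum-zeroʳ {n} i

prefixSum-const : ∀ n x → prefixSum {n} n (λ _ → x) ≡ n * x
prefixSum-const zero    x = refl
prefixSum-const (suc n) x = cong (x +_) (prefixSum-const n x)

prefixSum-distrib-+ : ∀ {n} i (f g : Fin n → ℕ) →
  prefixSum i (λ x → f x + g x) ≡ prefixSum i f + prefixSum i g
prefixSum-distrib-+ {zero}  i       f g = refl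
prefixSum-distrib-+ {suc n} zero    f g = refl
prefixSum-distrib-+ {suc n} (suc i) f g =
  trans (cong (f fzero + g fzero +_) (prefixSum-distrib-+ i (λ x → f (fsuc x)) (λ x → g (fsuc x))))
        (+-interchange (f fzero) (g fzero) _ _)

prefixSum-mono-≤ : ∀ {n} i {f g : Fin n → ℕ} → (∀ x → f x ≤ g x) → prefixSum i f ≤ prefixSum i g
prefixSum-mono-≤ {zero}  i       f≤g = z≤n
prefixSum-mono-≤ {suc n} zero    f≤g = z≤n
prefixSum-mono-≤ {suc n} (suc i) f≤g = +-mono-≤ (f≤g fzero) (prefixSum-mono-≤ i (λ x → f≤g (fsuc x)))

prefixSum-swap : ∀ {m n} i j (F : Fin m → Fin n → ℕ) →
  prefixSum i (λ r → prefixSum j (F r)) ≡ prefixSum j (λ c → prefixSum i (λ r → F r c))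
prefixSum-swap {zero}  {n} i       j F = sym (prefixSum-zeroʳ {n} j)
prefixSum-swap {suc m} {n} zero    j F = sym (prefixSum-zeroʳ {n} j)
prefixSum-swap {suc m} {n} (suc i) j F =
  trans (cong (prefixSum j (F fzero) +_) (prefixSum-swap i j (λ r → F (fsuc r))))
        (sym (prefixSum-distrib-+ j (F fzero) (λ c → prefixSum i (λ r → F (fsuc r) c))))

prefixSum-cumulative : ∀ n (g : Fin n → ℕ) →
  prefixSum {n} n (λ i → prefixSum (suc (toℕ i)) g) ≡ prefixSum {n} n (λ r → (n ∸ toℕ r) * g r)
prefixSum-cumulative zero    g = refl
prefixSum-cumulative (suc n) g =
  begin
    (g fzero + prefixSum 0 g′) + prefixSum {n} n (λ i → g fzero + prefixSum (suc (toℕ i)) g′)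
  ≡⟨ cong₂ _+_ (trans (cong (g fzero +_) (prefixSum-zeroˡ g′)) (+-identityʳ (g fzero)))
               (prefixSum-distrib-+ {n} n (λ _ → g fzero) (λ i → prefixSum (suc (toℕ i)) g′)) ⟩
    g fzero + (prefixSum {n} n (λ _ → g fzero) + prefixSum {n} n (λ i → prefixSum (suc (toℕ i)) g′))
  ≡⟨ cong₂ (λ x y → g fzero + (x + y)) (prefixSum-const n (g fzero)) (prefixSum-cumulative n g′) ⟩
    g fzero + (n * g fzero + prefixSum {n} n (λ r → (n ∸ toℕ r) * g′ r))
  ≡⟨ sym (+-assoc (g fzero) _ _) ⟩
    suc n * g fzero + prefixSum {n} n (λ r → (n ∸ toℕ r) * g′ r)
  ∎
  where
  open ≡-Reasoning
  g′ : Fin n → ℕ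
  g′ x = g (fsuc x)

+-≤-≡⇒≡ : ∀ {a b c d} → a ≤ c → b ≤ d → a + b ≡ c + d → a ≡ c × b ≡ d
+-≤-≡⇒≡ {a} {b} {c} {d} a≤c b≤d a+b≡c+d =
  a≡c , +-cancelˡ-≡ a b d (trans a+b≡c+d (cong (_+ d) (sym a≡c)))
  where
  a≡c : a ≡ c
  a≡c = ≤-antisym a≤c (+-cancelʳ-≤ d c a (subst (_≤ a + d) a+b≡c+d (+-monoʳ-≤ a b≤d)))

prefixSum-≤-≡⇒≗ : ∀ n {f g : Fin n → ℕ} → (∀ x → f x ≤ g x) →
  prefixSum n f ≡ prefixSum n g → ∀ x → f x ≡ g x
prefixSum-≤-≡⇒≗ (suc n) {f} {g} f≤g eq = f≗g
  where
  split : f fzero ≡ g fzero × prefixSum n (f ∘ fsuc) ≡ prefixSum n (g ∘ fsuc)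
  split = +-≤-≡⇒≡ (f≤g fzero) (prefixSum-mono-≤ n (f≤g ∘ fsuc)) eq
  f≗g : ∀ x → f x ≡ g x
  f≗g fzero    = proj₁ split
  f≗g (fsuc x) = prefixSum-≤-≡⇒≗ n (f≤g ∘ fsuc) (proj₂ split) x

prefixSum-injective : ∀ {n} {f g : Fin n → ℕ} →
  (∀ (i : Fin n) → prefixSum (suc (toℕ i)) f ≡ prefixSum (suc (toℕ i)) g) → ∀ x → f x ≡ g x
prefixSum-injective {suc n} {f} {g} eq = f≗g
  where
  head≡ : f fzero ≡ g fzero
  head≡ = +-cancelʳ-≡ 0 (f fzero) (g fzero)
    (subst₂ (λ u v → f fzero + u ≡ g fzero + v)
            (prefixSum-zeroˡ {n} (f ∘ fsuc)) (prefixSum-zeroˡ {n} (g ∘ fsuc)) (eq fzero))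
  f≗g : ∀ x → f x ≡ g x
  f≗g fzero    = head≡
  f≗g (fsuc x) = prefixSum-injective {n} {f ∘ fsuc} {g ∘ fsuc}
    (λ i → +-cancelˡ-≡ (f fzero) _ _ (trans (eq (fsuc i)) (cong (_+ _) (sym head≡)))) x

prefixSum-sift : ∀ n (f : ℕ → ℕ) {a} → a < n →
  prefixSum {n} n (λ c → f (toℕ c) * b2n (toℕ c ≡ᵇ a)) ≡ f a
prefixSum-sift (suc n) f {zero}  _         =
  trans (cong₂ _+_ (*-identityʳ (f 0))
                   (trans (prefixSum-cong {n} n (λ c → *-zeroʳ (f (suc (toℕ c))))) (prefixSum-zeroʳ {n} n)))
        (+-identityʳ (f 0))
prefixSum-sift (suc n) f {suc a} (s≤s a<n) =
  trans (cong (_+ prefixSum {n} n (λ c → f (suc (toℕ c)) * b2n (toℕ c ≡ᵇ a))) (*-zeroʳ (f 0)))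
        (prefixSum-sift n (f ∘ suc) a<n)

triangle : ℕ → ℕ
triangle zero    = 0
triangle (suc n) = suc n + triangle n

triangle-double : ∀ n → triangle n + triangle n ≡ n * suc n
triangle-double zero    = refl
triangle-double (suc n) =
  trans (+-+-shuffle n (triangle n)) (trans (cong (λ t → suc n + suc n + t) (triangle-double n)) (gauss-step n))
  where
  +-+-shuffle : ∀ n t → (suc n + t) + (suc n + t) ≡ suc n + suc n + (t + t)
  +-+-shuffle = solve-∀
  gauss-step : ∀ n → suc n + suc n + n * suc n ≡ suc n * suc (suc n)
  gauss-step = solve-∀

module _ {A : Set} where

  weightedSum : (A → ℕ) → List A → ℕ
  weightedSum g []       = 0
  weightedSum g (x ∷ xs) = length (x ∷ xs) * g x + weightedSum g xs

  length-concat-const : ∀ {c} {xss : List (List A)} → All (λ xs → length xs ≡ c) xss →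
    length (concat xss) ≡ length xss * c
  length-concat-const {xss = []}       []           = refl
  length-concat-const {xss = xs ∷ xss} (len ∷ lens) =
    trans (length-++ xs) (cong₂ _+_ len (length-concat-const lens))

  sum-map-zero : ∀ {g : A → ℕ} {xs} → All (λ x → g x ≡ 0) xs → sum (map g xs) ≡ 0
  sum-map-zero []            = refl
  sum-map-zero (gx≡0 ∷ gxs≡0) = cong₂ _+_ gx≡0 (sum-map-zero gxs≡0)

  AllPairs-mapWithAll : ∀ {P : A → Set} {R S : A → A → Set} →
    (∀ {x y} → P x → P y → R x y → S x y) → ∀ {xs} → All P xs → AllPairs R xs → AllPairs S xs
  AllPairs-mapWithAll f []         []         = []
  AllPairs-mapWithAll f (px ∷ pxs) (Rx ∷ Rxs) =
    All.zipWith (λ (py , Rxy) → f px py Rxy) (pxs , Rx) ∷ AllPairs-mapWithAll f pxs Rxs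

  inserts₁ : A → List A → List (List A)
  inserts₁ x []       = (x ∷ []) ∷ []
  inserts₁ x (y ∷ ys) = (x ∷ y ∷ ys) ∷ map (y ∷_) (inserts₁ x ys)

  inserts₂ : A → List A → List (List A)
  inserts₂ x []       = (x ∷ x ∷ []) ∷ []
  inserts₂ x (y ∷ ys) = map (x ∷_) (inserts₁ x (y ∷ ys)) ++ map (y ∷_) (inserts₂ x ys)

  length-inserts₁ : ∀ x u → length (inserts₁ x u) ≡ suc (length u)
  length-inserts₁ x []       = refl
  length-inserts₁ x (y ∷ ys) =
    cong suc (trans (length-map (y ∷_) (inserts₁ x ys)) (length-inserts₁ x ys))

  length-inserts₂ : ∀ x u → length (inserts₂ x u) ≡ triangle (suc (length u))
  length-inserts₂ x []       = refl
  length-inserts₂ x (y ∷ ys) =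
    trans (length-++ (map (x ∷_) (inserts₁ x (y ∷ ys))))
          (cong₂ _+_ (trans (length-map (x ∷_) (inserts₁ x (y ∷ ys))) (length-inserts₁ x (y ∷ ys)))
                     (trans (length-map (y ∷_) (inserts₂ x ys)) (length-inserts₂ x ys)))

  inserts₁-↭ : ∀ x u → All (_↭ x ∷ u) (inserts₁ x u)
  inserts₁-↭ x []       = ↭-refl ∷ []
  inserts₁-↭ x (y ∷ ys) =
    ↭-refl ∷
    All.map⁺ (All.map (λ r↭ → ↭-trans (↭-prep y r↭) (↭-swap y x ↭-refl)) (inserts₁-↭ x ys))

  inserts₂-↭ : ∀ x u → All (_↭ x ∷ x ∷ u) (inserts₂ x u)
  inserts₂-↭ x []       = ↭-refl ∷ []
  inserts₂-↭ x (y ∷ ys) = All.++⁺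
    (All.map⁺ (All.map (↭-prep x) (inserts₁-↭ x (y ∷ ys))))
    (All.map⁺ (All.map (λ r↭ → ↭-trans (↭-prep y r↭) y∷x∷x∷ys↭) (inserts₂-↭ x ys)))
    where
    y∷x∷x∷ys↭ : y ∷ x ∷ x ∷ ys ↭ x ∷ x ∷ y ∷ ys
    y∷x∷x∷ys↭ = ↭-trans (↭-swap y x ↭-refl) (↭-prep x (↭-swap y x ↭-refl))

  private
    cons-unique : ∀ (y : A) {rs : List (List A)} → AllPairs _≢_ rs → AllPairs _≢_ (map (y ∷_) rs)
    cons-unique y rs-unique =
      AllPairs.map⁺ (AllPairs.map (λ r≢r′ → r≢r′ ∘ ∷-injectiveʳ) rs-unique)

    cons-apart : ∀ {x y : A} → x ≢ y → ∀ (rs rs′ : List (List A)) →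
      All (λ r → All (r ≢_) (map (y ∷_) rs′)) (map (x ∷_) rs)
    cons-apart x≢y rs rs′ =
      All.map⁺ (All.universal (λ _ → All.map⁺ (All.universal (λ _ → x≢y ∘ ∷-injectiveˡ) rs′)) rs)

  inserts₁-unique : ∀ {x u} → All (x ≢_) u → AllPairs _≢_ (inserts₁ x u)
  inserts₁-unique {x} {[]}     []              = [] ∷ []
  inserts₁-unique {x} {y ∷ ys} (x≢y ∷ x∉ys) =
    All.head (cons-apart x≢y ((y ∷ ys) ∷ []) (inserts₁ x ys)) ∷ cons-unique y (inserts₁-unique x∉ys)

  inserts₂-unique : ∀ {x u} → All (x ≢_) u → AllPairs _≢_ (inserts₂ x u)
  inserts₂-unique {x} {[]}     []                   = [] ∷ []
  inserts₂-unique {x} {y ∷ ys} x∉u@(x≢y ∷ x∉ys) = AllPairs.++⁺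
    (cons-unique x (inserts₁-unique x∉u)) (cons-unique y (inserts₂-unique x∉ys))
    (cons-apart x≢y (inserts₁ x (y ∷ ys)) (inserts₂ x ys))

  module _ (_≟_ : DecidableEquality A) where

    erase : A → List A → List A
    erase x = filter (λ y → ¬? (x ≟ y))

    private
      erase-here : ∀ x r → erase x (x ∷ r) ≡ erase x r
      erase-here x r = filter-reject (λ y → ¬? (x ≟ y)) (λ x≢x → x≢x refl)

      erase-there : ∀ {x y} r → x ≢ y → erase x (y ∷ r) ≡ y ∷ erase x r
      erase-there r x≢y = filter-accept (λ y → ¬? (_ ≟ y)) x≢y

    erase-inserts₁ : ∀ {x u} → All (x ≢_) u → All (λ r → erase x r ≡ u) (inserts₁ x u)
    erase-inserts₁ {x} {[]}     []              = erase-here x [] ∷ []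
    erase-inserts₁ {x} {y ∷ ys} x∉u@(x≢y ∷ x∉ys) =
      trans (erase-here x (y ∷ ys)) (filter-all (λ y → ¬? (x ≟ y)) x∉u) ∷
      All.map⁺ (All.map (λ {r} e → trans (erase-there r x≢y) (cong (y ∷_) e)) (erase-inserts₁ x∉ys))

    erase-inserts₂ : ∀ {x u} → All (x ≢_) u → All (λ r → erase x r ≡ u) (inserts₂ x u)
    erase-inserts₂ {x} {[]}     []              = trans (erase-here x (x ∷ [])) (erase-here x []) ∷ []
    erase-inserts₂ {x} {y ∷ ys} x∉u@(x≢y ∷ x∉ys) = All.++⁺
      (All.map⁺ (All.map (λ {r} e → trans (erase-here x r) e) (erase-inserts₁ x∉u)))
      (All.map⁺ (All.map (λ {r} e → trans (erase-there r x≢y) (cong (y ∷_) e)) (erase-inserts₂ x∉ys)))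

    inserts₂-disjoint : ∀ {x u u′} → All (x ≢_) u → All (x ≢_) u′ → u ≢ u′ →
      All (λ r → All (r ≢_) (inserts₂ x u′)) (inserts₂ x u)
    inserts₂-disjoint {x} x∉u x∉u′ u≢u′ =
      All.map (λ er≡u → All.map (λ er′≡u′ r≡r′ → u≢u′ (trans (sym er≡u) (trans (cong (erase x) r≡r′) er′≡u′)))
                                (erase-inserts₂ x∉u′))
              (erase-inserts₂ x∉u)

-- The Bruhat weight

σ-at : ∀ {m n} → Matrix01 m n → Fin m → Fin n → ℕ
σ-at A i j = σ A (suc (toℕ i)) (suc (toℕ j))

weight : ∀ {m n} → Matrix01 m n → ℕ
weight {m} {n} A = prefixSum {m} m (λ i → prefixSum {n} n (σ-at A i))

weight-entries : ∀ {m n} (A : Matrix01 m n) →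
  weight A ≡ prefixSum {m} m (λ r → (m ∸ toℕ r) * prefixSum {n} n (λ c → (n ∸ toℕ c) * b2n (A r c)))
weight-entries {m} {n} A =
  begin
    prefixSum {m} m (λ i → prefixSum {n} n (λ j → prefixSum (suc (toℕ i)) (λ r → R r j)))
  ≡⟨ prefixSum-cong {m} m (λ i → sym (prefixSum-swap (suc (toℕ i)) n R)) ⟩
    prefixSum {m} m (λ i → prefixSum (suc (toℕ i)) (λ r → prefixSum {n} n (R r)))
  ≡⟨ prefixSum-cong {m} m (λ i → prefixSum-cong (suc (toℕ i)) (λ r → prefixSum-cumulative n (b2n ∘ A r))) ⟩
    prefixSum {m} m (λ i → prefixSum (suc (toℕ i)) (λ r → Σ-weighted r))
  ≡⟨ prefixSum-cumulative m Σ-weighted ⟩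
    prefixSum {m} m (λ r → (m ∸ toℕ r) * Σ-weighted r)
  ∎
  where
  open ≡-Reasoning
  R : Fin m → Fin n → ℕ
  R r j = prefixSum (suc (toℕ j)) (b2n ∘ A r)
  Σ-weighted : Fin m → ℕ
  Σ-weighted r = prefixSum {n} n (λ c → (n ∸ toℕ c) * b2n (A r c))

_≋_ : ∀ {m n} → Matrix01 m n → Matrix01 m n → Set
A ≋ C = ∀ r c → A r c ≡ C r c

b2n-injective : ∀ {x y} → b2n x ≡ b2n y → x ≡ y
b2n-injective {true}  {true}  _ = refl
b2n-injective {false} {false} _ = refl

σ-injective : ∀ {m n} {A C : Matrix01 m n} → (∀ i j → σ-at A i j ≡ σ-at C i j) → A ≋ C
σ-injective {n = n} {A} {C} σ≡ r c = b2n-injective (prefixSum-injective (rowPrefix≡ r) c)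
  where
  rowPrefix≡ : ∀ r (j : Fin n) → prefixSum (suc (toℕ j)) (b2n ∘ A r) ≡ prefixSum (suc (toℕ j)) (b2n ∘ C r)
  rowPrefix≡ r j = prefixSum-injective
    {f = λ r → prefixSum (suc (toℕ j)) (b2n ∘ A r)} {g = λ r → prefixSum (suc (toℕ j)) (b2n ∘ C r)}
    (λ i → σ≡ i j) r

⪯B∧weight≡⇒≋ : ∀ {m n} {A C : Matrix01 m n} → A ⪯B C → weight A ≡ weight C → A ≋ C
⪯B∧weight≡⇒≋ {m} {n} {A} {C} A⪯C weight≡ = σ-injective (λ i j → sym (σ≡ i j))
  where
  rows≡ : ∀ i → prefixSum {n} n (σ-at C i) ≡ prefixSum {n} n (σ-at A i)
  rows≡ = prefixSum-≤-≡⇒≗ m (λ i → prefixSum-mono-≤ n (A⪯C i)) (sym weight≡)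
  σ≡ : ∀ i j → σ-at C i j ≡ σ-at A i j
  σ≡ i = prefixSum-≤-≡⇒≗ n (A⪯C i) (rows≡ i)

≉⇒Distinct : ∀ {m n} {A C : Matrix01 m n} → ¬ A ≋ C → Distinct A C
≉⇒Distinct {m} {n} {A} {C} A≉C
  with ¬∀⟶∃¬ m (λ r → ∀ c → A r c ≡ C r c) (λ r → all? (λ c → A r c Bool.≟ C r c)) A≉C
... | r , Ar≉Cr with ¬∀⟶∃¬ n (λ c → A r c ≡ C r c) (λ c → A r c Bool.≟ C r c) Ar≉Cr
... | c , Arc≢Crc = r , c , Arc≢Crc

weight≡∧≉⇒Incomparable : ∀ {m n} {A C : Matrix01 m n} →
  weight A ≡ weight C → ¬ A ≋ C → Incomparable A C
weight≡∧≉⇒Incomparable weight≡ A≉C =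
  (λ A⪯C → A≉C (⪯B∧weight≡⇒≋ A⪯C weight≡)) ,
  (λ C⪯A → A≉C (λ r c → sym (⪯B∧weight≡⇒≋ C⪯A (sym weight≡) r c)))

-- Matrices given by the two columns of each row

Cols : Set
Cols = ℕ × ℕ

_∈ᵇ_ : ℕ → Cols → Bool
c ∈ᵇ (a , b) = (c ≡ᵇ a) ∨ (c ≡ᵇ b)

ColsIn : ℕ → Cols → Set
ColsIn n (a , b) = a < b × b < n

record RowList (n : ℕ) (e : List Cols) : Set where
  constructor mkRowList
  field
    length≡ : length e ≡ n
    allColsIn : All (ColsIn n) e

-- Rows past the end of the list read as the junk pair (0 , 0), which RowList rules out.
rowAt : ℕ → List Cols → Cols
rowAt _       []      = (0 , 0)
rowAt zero    (p ∷ _) = p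
rowAt (suc r) (_ ∷ e) = rowAt r e

fromRows : (n : ℕ) → List Cols → Matrix01 n n
fromRows n e r c = toℕ c ∈ᵇ rowAt (toℕ r) e

rowWeight : ℕ → Cols → ℕ
rowWeight n (a , b) = (n ∸ a) + (n ∸ b)

b2n-∨ : ∀ {x y} → ¬ (T x × T y) → b2n (x ∨ y) ≡ b2n x + b2n y
b2n-∨ {true}  {true}  ¬both = ⊥-elim (¬both (_ , _))
b2n-∨ {true}  {false} _     = refl
b2n-∨ {false} {_}     _     = refl

b2n-T : ∀ {x} → T x → b2n x ≡ 1
b2n-T {true} _ = refl

b2n-¬T : ∀ {x} → ¬ T x → b2n x ≡ 0
b2n-¬T {true}  ¬t = ⊥-elim (¬t _)
b2n-¬T {false} _  = refl

T-∈ᵇ : ∀ {c a b} → T (c ∈ᵇ (a , b)) → c ≡ a ⊎ c ≡ b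
T-∈ᵇ {c} {a} {b} t = Sum.map (≡ᵇ⇒≡ c a) (≡ᵇ⇒≡ c b) (Equivalence.to T-∨ t)

b2n-∉ᵇ : ∀ {c a b} → c ≢ a → c ≢ b → b2n (c ∈ᵇ (a , b)) ≡ 0
b2n-∉ᵇ c≢a c≢b = b2n-¬T (Sum.[ c≢a , c≢b ] ∘ T-∈ᵇ)

∈ᵇ-left : ∀ a b → T (a ∈ᵇ (a , b))
∈ᵇ-left a b = Equivalence.from T-∨ (inj₁ (≡⇒≡ᵇ a a refl))

∈ᵇ-right : ∀ a b → T (b ∈ᵇ (a , b))
∈ᵇ-right a b = Equivalence.from T-∨ (inj₂ (≡⇒≡ᵇ b b refl))

prefixSum-∈ᵇ : ∀ n (f : ℕ → ℕ) {a b} → ColsIn n (a , b) →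
  prefixSum {n} n (λ c → f (toℕ c) * b2n (toℕ c ∈ᵇ (a , b))) ≡ f a + f b
prefixSum-∈ᵇ n f {a} {b} (a<b , b<n) =
  begin
    prefixSum {n} n (λ c → f (toℕ c) * b2n (toℕ c ∈ᵇ (a , b)))
  ≡⟨ prefixSum-cong {n} n (λ c → trans (cong (f (toℕ c) *_) (b2n-∨ (a≢b ∘ both (toℕ c))))
                                        (*-distribˡ-+ (f (toℕ c)) _ _)) ⟩
    prefixSum {n} n (λ c → f (toℕ c) * b2n (toℕ c ≡ᵇ a) + f (toℕ c) * b2n (toℕ c ≡ᵇ b))
  ≡⟨ prefixSum-distrib-+ {n} n _ _ ⟩
    prefixSum {n} n (λ c → f (toℕ c) * b2n (toℕ c ≡ᵇ a)) +
    prefixSum {n} n (λ c → f (toℕ c) * b2n (toℕ c ≡ᵇ b))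
  ≡⟨ cong₂ _+_ (prefixSum-sift n f (<-trans a<b b<n)) (prefixSum-sift n f b<n) ⟩
    f a + f b
  ∎
  where
  open ≡-Reasoning
  a≢b = <⇒≢ a<b
  both : ∀ c → T (c ≡ᵇ a) × T (c ≡ᵇ b) → a ≡ b
  both c (c≡a , c≡b) = trans (sym (≡ᵇ⇒≡ c a c≡a)) (≡ᵇ⇒≡ c b c≡b)

rowAt-All : ∀ {P : Cols → Set} e r → All P e → r < length e → P (rowAt r e)
rowAt-All (p ∷ e) zero    (Pp ∷ _)  _        = Pp
rowAt-All (p ∷ e) (suc r) (_ ∷ Pe) (s≤s r<) = rowAt-All e r Pe r<

prefixSum-rowAt : ∀ n e (g : Cols → ℕ) → length e ≡ n →
  prefixSum {n} n (λ r → g (rowAt (toℕ r) e)) ≡ sum (map g e)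
prefixSum-rowAt zero    []      g _   = refl
prefixSum-rowAt (suc n) (p ∷ e) g len = cong (g p +_) (prefixSum-rowAt n e g (suc-injective len))

prefixSum-rowAt-weighted : ∀ n e (g : Cols → ℕ) → length e ≡ n →
  prefixSum {n} n (λ r → (n ∸ toℕ r) * g (rowAt (toℕ r) e)) ≡ weightedSum g e
prefixSum-rowAt-weighted zero    []      g _   = refl
prefixSum-rowAt-weighted (suc n) (p ∷ e) g len =
  cong₂ _+_ (cong (_* g p) (sym len)) (prefixSum-rowAt-weighted n e g (suc-injective len))

module _ {n e} (rows : RowList n e) where

  open RowList rows

  ColsIn-rowAt : ∀ (r : Fin n) → ColsIn n (rowAt (toℕ r) e)
  ColsIn-rowAt r = rowAt-All e (toℕ r) allColsIn (subst (toℕ r <_) (sym length≡) (toℕ<n r))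

  rowSum-fromRows : ∀ r → rowSum (fromRows n e) r ≡ 2
  rowSum-fromRows r =
    trans (prefixSum-cong {n} n (λ c → sym (*-identityˡ _))) (prefixSum-∈ᵇ n (λ _ → 1) (ColsIn-rowAt r))

  colSum-fromRows : ∀ c → colSum (fromRows n e) c ≡ sum (map (λ p → b2n (toℕ c ∈ᵇ p)) e)
  colSum-fromRows c = prefixSum-rowAt n e (λ p → b2n (toℕ c ∈ᵇ p)) length≡

  weight-fromRows : weight (fromRows n e) ≡ weightedSum (rowWeight n) e
  weight-fromRows =
    trans (weight-entries (fromRows n e))
    (trans (prefixSum-cong {n} n (λ r → cong ((n ∸ toℕ r) *_) (prefixSum-∈ᵇ n (n ∸_) (ColsIn-rowAt r))))
           (prefixSum-rowAt-weighted n e (rowWeight n) length≡))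

∈ᵇ-injective : ∀ {n p q} → ColsIn n p → ColsIn n q → (∀ c → c < n → c ∈ᵇ p ≡ c ∈ᵇ q) → p ≡ q
∈ᵇ-injective {n} {a , b} {a′ , b′} (a<b , b<n) (a′<b′ , b′<n) p≐q
  with T-∈ᵇ {a} {a′} {b′} (subst T (p≐q a (<-trans a<b b<n)) (∈ᵇ-left a b))
     | T-∈ᵇ {b} {a′} {b′} (subst T (p≐q b b<n) (∈ᵇ-right a b))
     | T-∈ᵇ {a′} {a} {b} (subst T (sym (p≐q a′ (<-trans a′<b′ b′<n))) (∈ᵇ-left a′ b′))
... | inj₁ refl | inj₁ refl | _         = ⊥-elim (<-irrefl refl a<b)
... | inj₁ refl | inj₂ refl | _         = refl
... | inj₂ refl | _         | inj₁ refl = ⊥-elim (<-irrefl refl a′<b′)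
... | inj₂ refl | _         | inj₂ refl = ⊥-elim (<-asym a<b a′<b′)

rowAt-injective : ∀ {n e e′} → length e ≡ n → length e′ ≡ n →
  (∀ (r : Fin n) → rowAt (toℕ r) e ≡ rowAt (toℕ r) e′) → e ≡ e′
rowAt-injective {zero}  {[]}    {[]}      _   _    _ = refl
rowAt-injective {suc n} {p ∷ e} {p′ ∷ e′} len len′ e≐e′ =
  cong₂ _∷_ (e≐e′ fzero) (rowAt-injective (suc-injective len) (suc-injective len′) (e≐e′ ∘ fsuc))

fromRows-injective : ∀ {n e e′} → RowList n e → RowList n e′ → fromRows n e ≋ fromRows n e′ → e ≡ e′
fromRows-injective {n} {e} {e′} e-rows e′-rows A≋A′ =
  rowAt-injective (RowList.length≡ e-rows) (RowList.length≡ e′-rows)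
    (λ r → ∈ᵇ-injective (ColsIn-rowAt e-rows r) (ColsIn-rowAt e′-rows r) (row≡ r))
  where
  row≡ : ∀ r c → c < n → c ∈ᵇ rowAt (toℕ r) e ≡ c ∈ᵇ rowAt (toℕ r) e′
  row≡ r c c<n =
    subst (λ c → c ∈ᵇ rowAt (toℕ r) e ≡ c ∈ᵇ rowAt (toℕ r) e′) (toℕ-fromℕ< c<n) (A≋A′ r (fromℕ< c<n))

dim : ℕ → ℕ
dim k = suc (2 * suc k)

dim-suc : ∀ k → 2 * suc (suc k) ≡ suc (dim k)
dim-suc k = 2*[2+k]≡ k
  where
  2*[2+k]≡ : ∀ k → 2 * (2 + k) ≡ 2 + 2 * (1 + k)
  2*[2+k]≡ = solve-∀

2+k<dim : ∀ k → suc (suc k) < dim k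
2+k<dim k = s≤s (subst (suc (suc k) ≤_) (sym (2*[1+k]≡ k)) (s≤s (s≤s (m≤m+n k k))))
  where
  2*[1+k]≡ : ∀ k → 2 * (1 + k) ≡ 2 + (k + k)
  2*[1+k]≡ = solve-∀

data Letter : Set where
  block : Letter
  pair  : ℕ → ℕ → Letter

_≟ᴸ_ : DecidableEquality Letter
block    ≟ᴸ block      = yes refl
block    ≟ᴸ pair _ _   = no λ ()
pair _ _ ≟ᴸ block      = no λ ()
pair a b ≟ᴸ pair a′ b′ =
  map′ (λ { (refl , refl) → refl }) (λ { refl → refl , refl }) ((a ≟ a′) ×-dec (b ≟ b′))

expand : ℕ → List Letter → List Cols
expand k []             = []
expand k (block ∷ w)    = (k , suc k) ∷ (suc k , suc (suc k)) ∷ expand k w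
expand k (pair a b ∷ w) = (a , b) ∷ expand k w

Neutral : ℕ → Letter → Set
Neutral k block      = ⊤
Neutral k (pair a b) = a < b × b < dim k × a + b ≡ 2 * suc k

isBlock : Letter → ℕ
isBlock block      = 1
isBlock (pair _ _) = 0

blocks : List Letter → ℕ
blocks w = sum (map isBlock w)

hits : ℕ → ℕ → Letter → ℕ
hits k c block      = b2n (c ∈ᵇ (k , suc k)) + b2n (c ∈ᵇ (suc k , suc (suc k)))
hits k c (pair a b) = b2n (c ∈ᵇ (a , b))

hits-expand : ∀ k c w → sum (map (λ p → b2n (c ∈ᵇ p)) (expand k w)) ≡ sum (map (hits k c) w)
hits-expand k c []             = refl
hits-expand k c (block ∷ w)    =
  trans (cong (λ s → b2n (c ∈ᵇ (k , suc k)) + (b2n (c ∈ᵇ (suc k , suc (suc k))) + s)) (hits-expand k c w))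
        (sym (+-assoc (b2n (c ∈ᵇ (k , suc k))) _ _))
hits-expand k c (pair a b ∷ w) = cong (b2n (c ∈ᵇ (a , b)) +_) (hits-expand k c w)

hits-beyond : ∀ {k c} ℓ → Neutral k ℓ → dim k ≤ c → hits k c ℓ ≡ 0
hits-beyond {k} {c} block      _                dim≤c =
  cong₂ _+_ (b2n-∉ᵇ (>⇒≢ k<c) (>⇒≢ 1+k<c)) (b2n-∉ᵇ (>⇒≢ 1+k<c) (>⇒≢ 2+k<c))
  where
  2+k<c = <-≤-trans (2+k<dim k) dim≤c
  1+k<c = <-trans (n<1+n (suc k)) 2+k<c
  k<c   = <-trans (n<1+n k) 1+k<c
hits-beyond {k} {c} (pair a b) (a<b , b<dim , _) dim≤c =
  b2n-∉ᵇ (>⇒≢ (<-trans a<b b<c)) (>⇒≢ b<c)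
  where
  b<c = <-≤-trans b<dim dim≤c

length-expand : ∀ k w → length (expand k w) ≡ length w + blocks w
length-expand k []             = refl
length-expand k (block ∷ w)    =
  cong suc (trans (cong suc (length-expand k w)) (sym (+-suc (length w) (blocks w))))
length-expand k (pair _ _ ∷ w) = cong suc (length-expand k w)

expand-ColsIn : ∀ k {w} → All (Neutral k) w → All (ColsIn (dim k)) (expand k w)
expand-ColsIn k {[]}           []                           = []
expand-ColsIn k {block ∷ w}    (_ ∷ neutral)                =
  (n<1+n k , <-trans (n<1+n (suc k)) (2+k<dim k)) ∷ (n<1+n (suc k) , 2+k<dim k) ∷ expand-ColsIn k neutral
expand-ColsIn k {pair _ _ ∷ w} ((a<b , b<dim , _) ∷ neutral) = (a<b , b<dim) ∷ expand-ColsIn k neutral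

block≢neutral : ∀ {k a b} → Neutral k (pair a b) → (k , suc k) ≢ (a , b)
block≢neutral {k} (_ , _ , a+b≡) eq = 1+n≢n (sym (trans (trans (cong (uncurry _+_) eq) a+b≡) (arith k)))
  where
  arith : ∀ k → 2 * suc k ≡ suc (k + suc k)
  arith = solve-∀

expand-injective : ∀ k {w w′} → All (Neutral k) w → All (Neutral k) w′ → expand k w ≡ expand k w′ → w ≡ w′
expand-injective k {[]}           {[]}             _                _                eq = refl
expand-injective k {block ∷ w}    {block ∷ w′}     (_ ∷ neutral)    (_ ∷ neutral′)   eq =
  cong (block ∷_) (expand-injective k neutral neutral′ (∷-injectiveʳ (∷-injectiveʳ eq)))
expand-injective k {pair _ _ ∷ w} {pair _ _ ∷ w′}  (_ ∷ neutral)    (_ ∷ neutral′)   eq =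
  cong₂ _∷_ (cong (uncurry pair) (∷-injectiveˡ eq)) (expand-injective k neutral neutral′ (∷-injectiveʳ eq))
expand-injective k {block ∷ _}    {pair _ _ ∷ _}   _                (neutral-ab ∷ _) eq =
  ⊥-elim (block≢neutral neutral-ab (∷-injectiveˡ eq))
expand-injective k {pair _ _ ∷ _} {block ∷ _}      (neutral-ab ∷ _) _                eq =
  ⊥-elim (block≢neutral neutral-ab (sym (∷-injectiveˡ eq)))
expand-injective k {[]}           {block ∷ _}      _ _ ()
expand-injective k {[]}           {pair _ _ ∷ _}   _ _ ()
expand-injective k {block ∷ _}    {[]}             _ _ ()
expand-injective k {pair _ _ ∷ _} {[]}             _ _ ()

rowWeight-≡ : ∀ {n a b} x → ColsIn n (a , b) → x + (a + b) ≡ n + n → rowWeight n (a , b) ≡ x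
rowWeight-≡ {n} {a} {b} x (a<b , b<n) x+a+b≡ = +-cancelʳ-≡ (a + b) _ x (trans rowWeight+a+b≡ (sym x+a+b≡))
  where
  rowWeight+a+b≡ : rowWeight n (a , b) + (a + b) ≡ n + n
  rowWeight+a+b≡ = trans (+-interchange (n ∸ a) (n ∸ b) a b)
                         (cong₂ _+_ (m∸n+n≡m (<⇒≤ (<-trans a<b b<n))) (m∸n+n≡m (<⇒≤ b<n)))

rowWeight-neutral : ∀ {k a b} → Neutral k (pair a b) → rowWeight (dim k) (a , b) ≡ suc (dim k)
rowWeight-neutral {k} (a<b , b<dim , a+b≡) =
  rowWeight-≡ (suc (dim k)) (a<b , b<dim) (trans (cong (suc (dim k) +_) a+b≡) (arith k))
  where
  arith : ∀ k → suc (suc (2 * suc k)) + 2 * suc k ≡ suc (2 * suc k) + suc (2 * suc k)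
  arith = solve-∀

rowWeight-block₁ : ∀ k → rowWeight (dim k) (k , suc k) ≡ suc (suc (dim k))
rowWeight-block₁ k = rowWeight-≡ (suc (suc (dim k))) (n<1+n k , <-trans (n<1+n (suc k)) (2+k<dim k)) (arith k)
  where
  arith : ∀ k → suc (suc (suc (2 * suc k))) + (k + suc k) ≡ suc (2 * suc k) + suc (2 * suc k)
  arith = solve-∀

rowWeight-block₂ : ∀ k → rowWeight (dim k) (suc k , suc (suc k)) ≡ dim k
rowWeight-block₂ k = rowWeight-≡ (dim k) (n<1+n (suc k) , 2+k<dim k) (arith k)
  where
  arith : ∀ k → suc (2 * suc k) + (suc k + suc (suc k)) ≡ suc (2 * suc k) + suc (2 * suc k)
  arith = solve-∀

weightedSum-expand : ∀ k {w} → All (Neutral k) w →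
  weightedSum (rowWeight (dim k)) (expand k w) ≡ suc (dim k) * triangle (length (expand k w)) + blocks w
weightedSum-expand k {[]}           []                     = sym (trans (+-identityʳ _) (*-zeroʳ (suc (dim k))))
weightedSum-expand k {block ∷ w}    (_ ∷ neutral)          =
  begin
    suc (suc L) * ρ (k , suc k) + (suc L * ρ (suc k , suc (suc k)) + weightedSum ρ (expand k w))
  ≡⟨ cong₂ (λ x y → suc (suc L) * x + (suc L * y + weightedSum ρ (expand k w)))
           (rowWeight-block₁ k) (rowWeight-block₂ k) ⟩
    suc (suc L) * suc (suc (dim k)) + (suc L * dim k + weightedSum ρ (expand k w))
  ≡⟨ cong (λ s → suc (suc L) * suc (suc (dim k)) + (suc L * dim k + s)) (weightedSum-expand k neutral) ⟩
    suc (suc L) * suc (suc (dim k)) + (suc L * dim k + (suc (dim k) * triangle L + blocks w))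
  ≡⟨ arith L (dim k) (triangle L) (blocks w) ⟩
    suc (dim k) * triangle (suc (suc L)) + suc (blocks w)
  ∎
  where
  open ≡-Reasoning
  ρ = rowWeight (dim k)
  L = length (expand k w)
  arith : ∀ L n t B →
    suc (suc L) * suc (suc n) + (suc L * n + (suc n * t + B)) ≡ suc n * (suc (suc L) + (suc L + t)) + suc B
  arith = solve-∀
weightedSum-expand k {pair a b ∷ w} (neutral-ab ∷ neutral) =
  begin
    suc L * rowWeight (dim k) (a , b) + weightedSum (rowWeight (dim k)) (expand k w)
  ≡⟨ cong₂ (λ x s → suc L * x + s) (rowWeight-neutral neutral-ab) (weightedSum-expand k neutral) ⟩
    suc L * suc (dim k) + (suc (dim k) * triangle L + blocks w)
  ≡⟨ arith L (dim k) (triangle L) (blocks w) ⟩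
    suc (dim k) * triangle (suc L) + blocks w
  ∎
  where
  open ≡-Reasoning
  L = length (expand k w)
  arith : ∀ L n t B → suc L * suc n + (suc n * t + B) ≡ suc n * (suc L + t) + B
  arith = solve-∀

-- The letter multiset and its arrangements

shift : Letter → Letter
shift block      = block
shift (pair a b) = pair (suc a) (suc b)

shift-injective : Injective _≡_ _≡_ shift
shift-injective {block}    {block}    _    = refl
shift-injective {pair _ _} {pair _ _} refl = refl

-- Shifted letters of level k leave exactly the columns 0 and dim k + 1 of level suc k empty.
outer : ℕ → Letter
outer k = pair 0 (suc (dim k))

letters : ℕ → List Letter
letters zero    = pair 0 2 ∷ block ∷ []
letters (suc k) = outer k ∷ outer k ∷ map shift (letters k)

words : ℕ → List (List Letter)
words zero    = inserts₁ (pair 0 2) (block ∷ [])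
words (suc k) = concatMap (inserts₂ (outer k) ∘ map shift) (words k)

shift-Neutral : ∀ {k} ℓ → Neutral k ℓ → Neutral (suc k) (shift ℓ)
shift-Neutral     block      _                    = tt
shift-Neutral {k} (pair a b) (a<b , b<dim , a+b≡) =
  s≤s a<b ,
  subst (suc b <_) (cong suc (sym (dim-suc k))) (s≤s (m<n⇒m<1+n b<dim)) ,
  trans (+-suc (suc a) b) (trans (cong (suc ∘ suc) a+b≡) (sym (dim-suc k)))

outer-Neutral : ∀ k → Neutral (suc k) (outer k)
outer-Neutral k = z<s , subst (suc (dim k) <_) (cong suc (sym (dim-suc k))) ≤-refl , sym (dim-suc k)

hits-shift : ∀ k c ℓ → hits (suc k) (suc c) (shift ℓ) ≡ hits k c ℓ
hits-shift k c block      = refl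
hits-shift k c (pair _ _) = refl

sum-map-shift : ∀ {g g′ : Letter → ℕ} → (∀ ℓ → g (shift ℓ) ≡ g′ ℓ) →
  ∀ w → sum (map g (map shift w)) ≡ sum (map g′ w)
sum-map-shift g∘shift≗g′ w = cong sum (trans (sym (map-∘ w)) (map-cong g∘shift≗g′ w))

letters-Neutral : ∀ k → All (Neutral k) (letters k)
letters-Neutral zero    = (z<s , s<s (s<s z<s) , refl) ∷ tt ∷ []
letters-Neutral (suc k) =
  outer-Neutral k ∷ outer-Neutral k ∷ All.map⁺ (All.map (λ {ℓ} → shift-Neutral ℓ) (letters-Neutral k))

length-letters : ∀ k → length (letters k) ≡ 2 * suc k
length-letters zero    = refl
length-letters (suc k) =
  trans (cong (suc ∘ suc) (trans (length-map shift (letters k)) (length-letters k))) (sym (dim-suc k))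

blocks-letters : ∀ k → blocks (letters k) ≡ 1
blocks-letters zero    = refl
blocks-letters (suc k) =
  trans (sum-map-shift (λ { block → refl ; (pair _ _) → refl }) (letters k)) (blocks-letters k)

hits-letters : ∀ k {c} → c < dim k → sum (map (hits k c) (letters k)) ≡ 2
hits-letters zero    {0} _ = refl
hits-letters zero    {1} _ = refl
hits-letters zero    {2} _ = refl
hits-letters zero    {suc (suc (suc _))} (s<s (s<s (s<s ())))
hits-letters (suc k) {zero} _ =
  cong (2 +_) (sum-map-zero (All.map⁺ (All.universal (λ { block → refl ; (pair _ _) → refl }) (letters k))))
hits-letters (suc k) {suc c} 1+c<dim
  with m≤n⇒m<n∨m≡n (≤-pred (subst (suc c ≤_) (dim-suc k) (≤-pred 1+c<dim)))
... | inj₁ c<dim = cong₂ (λ o s → o + (o + s)) (b2n-¬T (<⇒≢ c<dim ∘ ≡ᵇ⇒≡ c (dim k)))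
                         (trans (sum-map-shift (hits-shift k c) (letters k)) (hits-letters k c<dim))
... | inj₂ refl  = cong₂ (λ o s → o + (o + s)) (b2n-T (≡⇒≡ᵇ c c refl))
                         (trans (sum-map-shift (hits-shift k c) (letters k))
                                (sum-map-zero (All.map (λ {ℓ} ℓ-neutral → hits-beyond ℓ ℓ-neutral ≤-refl)
                                                       (letters-Neutral k))))

words-↭ : ∀ k → All (_↭ letters k) (words k)
words-↭ zero    = inserts₁-↭ (pair 0 2) (block ∷ [])
words-↭ (suc k) = All.concat⁺ (All.map⁺ (All.map (λ {w} w↭ →
    All.map (λ r↭ → ↭-trans r↭ (↭-prep (outer k) (↭-prep (outer k) (↭.map⁺ shift w↭))))
            (inserts₂-↭ (outer k) (map shift w)))
  (words-↭ k)))

outer∉shift : ∀ k w → All (outer k ≢_) (map shift w)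
outer∉shift k w = All.map⁺ (All.universal (λ { block () ; (pair _ _) () }) w)

words-unique : ∀ k → AllPairs _≢_ (words k)
words-unique zero    = inserts₁-unique ((λ ()) ∷ [])
words-unique (suc k) = AllPairs.concat⁺
  (All.map⁺ (All.universal (λ w → inserts₂-unique (outer∉shift k w)) (words k)))
  (AllPairs.map⁺ (AllPairs.map
    (λ w≢w′ → inserts₂-disjoint _≟ᴸ_ (outer∉shift k _) (outer∉shift k _)
                                 (w≢w′ ∘ map-injective shift-injective))
    (words-unique k)))

length-words : ∀ k → length (words k) * 2 ^ k ≡ (2 * suc k) !
length-words zero    = refl
length-words (suc k) =
  begin
    length (concat (map extend (words k))) * 2 ^ suc k
  ≡⟨ cong (_* 2 ^ suc k) (length-concat-const (All.map⁺ (All.map (λ {w} → length-extend w) (words-↭ k)))) ⟩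
    length (map extend (words k)) * triangle (dim k) * 2 ^ suc k
  ≡⟨ cong (λ l → l * triangle (dim k) * 2 ^ suc k) (length-map extend (words k)) ⟩
    length (words k) * triangle (dim k) * (2 * 2 ^ k)
  ≡⟨ arith (length (words k)) (triangle (dim k)) (2 ^ k) ⟩
    length (words k) * 2 ^ k * (triangle (dim k) + triangle (dim k))
  ≡⟨ cong₂ _*_ (length-words k) (triangle-double (dim k)) ⟩
    (2 * suc k) ! * (dim k * suc (dim k))
  ≡⟨ arith₂ ((2 * suc k) !) (dim k) ⟩
    suc (dim k) !
  ≡⟨ cong _! (sym (dim-suc k)) ⟩
    (2 * suc (suc k)) !
  ∎
  where
  open ≡-Reasoning
  extend : List Letter → List (List Letter)
  extend = inserts₂ (outer k) ∘ map shift
  length-extend : ∀ w → w ↭ letters k → length (extend w) ≡ triangle (dim k)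
  length-extend w w↭ = trans (length-inserts₂ (outer k) (map shift w))
    (cong (triangle ∘ suc) (trans (length-map shift w) (trans (↭-length w↭) (length-letters k))))
  arith : ∀ l t p → l * t * (2 * p) ≡ l * p * (t + t)
  arith = solve-∀
  arith₂ : ∀ f n → f * (n * suc n) ≡ suc n * (n * f)
  arith₂ = solve-∀

matrixOf : (k : ℕ) → List Letter → Matrix01 (dim k) (dim k)
matrixOf k w = fromRows (dim k) (expand k w)

module _ {k w} (w↭ : w ↭ letters k) where

  arrangement-Neutral : All (Neutral k) w
  arrangement-Neutral = All-resp-↭ (↭-sym w↭) (letters-Neutral k)

  blocks-arrangement : blocks w ≡ 1
  blocks-arrangement = trans (sum-↭ (↭.map⁺ isBlock w↭)) (blocks-letters k)

  expand-RowList : RowList (dim k) (expand k w)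
  expand-RowList = mkRowList
    (trans (length-expand k w)
           (trans (cong₂ _+_ (trans (↭-length w↭) (length-letters k)) blocks-arrangement) (+-comm _ 1)))
    (expand-ColsIn k arrangement-Neutral)

  matrixOf-InClassA : InClassA (dim k) 2 (matrixOf k w)
  matrixOf-InClassA = rowSum-fromRows expand-RowList , λ c →
    trans (colSum-fromRows expand-RowList c)
    (trans (hits-expand k (toℕ c) w)
    (trans (sum-↭ (↭.map⁺ (hits k (toℕ c)) w↭)) (hits-letters k (toℕ<n c))))

  weight-matrixOf : weight (matrixOf k w) ≡ suc (dim k) * triangle (dim k) + 1
  weight-matrixOf =
    trans (weight-fromRows expand-RowList)
    (trans (weightedSum-expand k arrangement-Neutral)
           (cong₂ (λ l b → suc (dim k) * triangle l + b) (RowList.length≡ expand-RowList) blocks-arrangement))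

matrixOf-apart : ∀ {k w w′} → w ↭ letters k → w′ ↭ letters k → w ≢ w′ →
  Distinct (matrixOf k w) (matrixOf k w′) × Incomparable (matrixOf k w) (matrixOf k w′)
matrixOf-apart {k} w↭ w′↭ w≢w′ =
  ≉⇒Distinct A≉A′ , weight≡∧≉⇒Incomparable (trans (weight-matrixOf w↭) (sym (weight-matrixOf w′↭))) A≉A′
  where
  A≉A′ = w≢w′ ∘ expand-injective k (arrangement-Neutral w↭) (arrangement-Neutral w′↭)
              ∘ fromRows-injective (expand-RowList w↭) (expand-RowList w′↭)

theorem5 : (n m : ℕ) → 3 ≤ n → n ≡ suc (2 * m) →
    Σ (List (Matrix01 n n)) λ L →
      IsAntichainA n 2 L × (length L * 2 ^ (m ∸ 1) ≡ (n ∸ 1) !)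
theorem5 _ zero    (s≤s ()) refl
theorem5 _ (suc k) _        refl =
  map (matrixOf k) (words k) ,
  (All.map⁺ (All.map matrixOf-InClassA (words-↭ k)) ,
   AllPairs.map⁺ (AllPairs-mapWithAll matrixOf-apart (words-↭ k) (words-unique k))) ,
  trans (cong (_* 2 ^ k) (length-map (matrixOf k) (words k))) (length-words k)
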